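{- Let $p$ be a prime and suppose $n \ge 2$ and $e \ge 1$ are integers. Then the number of subrings $R\subseteq\mathbb Z^n$ of index $p^e$ and corank exactly $1$ is $h_{n,1}(p^e) = \binom{n}{2}$.
   Context: For $u,w\in\mathbb Z^n$ let $u\circ w$ denote the componentwise product. A subring of $\mathbb Z^n$ is a finite-index subgroup $R\subseteq\mathbb Z^n$ closed under $\circ$ and containing $(1,1,\dots,1)$. The corank of $R$ is the rank (number of nontrivial invariant factors) of the finite abelian group $\mathbb Z^n/R$. $h_{n,k}(j)$ denotes the number of subrings of $\mathbb Z^n$ of index $j$ and corank exactly $k$. -}

module Defs where

open import Data.Nat as ℕ using (ℕ; zero; suc)
open import Data.Integer using (ℤ; +_; _+_; _-_; _*_; -_)
open import Data.Integer.Divisibility using (_∣_)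
open import Data.Nat.Divisibility using () renaming (_∣_ to _∣ℕ_)
open import Data.Fin using (Fin; toℕ) renaming (zero to fzero; suc to fsuc)
open import Data.Bool using (Bool; true)
open import Data.Product using (Σ; ∃; _×_; _,_)
open import Relation.Binary.PropositionalEquality using (_≡_)

Vecℤ : ℕ → Set
Vecℤ n = Fin n → ℤ

_⊕_ : ∀ {n} → Vecℤ n → Vecℤ n → Vecℤ n
(u ⊕ w) i = u i + w i

_⊖_ : ∀ {n} → Vecℤ n → Vecℤ n → Vecℤ n
(u ⊖ w) i = u i - w i

⊝_ : ∀ {n} → Vecℤ n → Vecℤ n
(⊝ u) i = - u i

_⊙_ : ∀ {n} → Vecℤ n → Vecℤ n → Vecℤ n
(u ⊙ w) i = u i * w i

𝟎 𝟏 : ∀ {n} → Vecℤ n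
𝟎 i = + 0
𝟏 i = + 1

dot : ∀ {n} → Vecℤ n → Vecℤ n → ℤ
dot {zero}  a v = + 0
dot {suc n} a v = a fzero * v fzero + dot {n} (λ j → a (fsuc j)) (λ j → v (fsuc j))

Subset : ℕ → Set
Subset n = Vecℤ n → Bool

_∈_ : ∀ {n} → Vecℤ n → Subset n → Set
v ∈ S = S v ≡ true

IsSubgroup : ∀ {n} → Subset n → Set
IsSubgroup S = (𝟎 ∈ S)
  × (∀ u w → u ∈ S → w ∈ S → (u ⊕ w) ∈ S)
  × (∀ u → u ∈ S → (⊝ u) ∈ S)

-- Index [ℤ^n : S] = N : a complete set of N pairwise incongruent coset representatives.
HasIndex : ∀ {n} → Subset n → ℕ → Set
HasIndex {n} S N = Σ (Fin N → Vecℤ n) λ r →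
    (∀ i j → (r i ⊖ r j) ∈ S → i ≡ j)
  × (∀ v → ∃ λ i → (v ⊖ r i) ∈ S)

IsSubring : ∀ {n} → Subset n → Set
IsSubring S = IsSubgroup S
  × (∃ λ N → HasIndex S N)
  × (∀ u w → u ∈ S → w ∈ S → (u ⊙ w) ∈ S)
  × (𝟏 ∈ S)

-- Corank k: ℤ^n / S ≅ ℤ/d₁ × … × ℤ/d_k with 1 < d₁ ∣ d₂ ∣ … ∣ d_k
-- (invariant factor decomposition with exactly k nontrivial factors).
-- The isomorphism is induced by a homomorphism φ : ℤ^n → ⊕ ℤ/dᵢ, given by an
-- integer matrix A (φ(v)ᵢ = Σⱼ A i j vⱼ mod dᵢ), surjective with kernel S.
HasCorank : ∀ {n} → Subset n → ℕ → Set
HasCorank {n} S k = Σ (Fin k → ℕ) λ d →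
    (∀ i → 1 ℕ.< d i)
  × (∀ i j → toℕ i ℕ.≤ toℕ j → d i ∣ℕ d j)
  × Σ (Fin k → Vecℤ n) λ A →
      (∀ v → v ∈ S → ∀ i → (+ d i) ∣ dot (A i) v)
    × (∀ v → (∀ i → (+ d i) ∣ dot (A i) v) → v ∈ S)
    × (∀ (w : Fin k → ℤ) → ∃ λ v → ∀ i → (+ d i) ∣ (dot (A i) v - w i))

SubringIC : ℕ → ℕ → ℕ → Set
SubringIC n k j = Σ (Subset n) λ S → IsSubring S × HasIndex S j × HasCorank S k

_≈S_ : ∀ {n k j} → SubringIC n k j → SubringIC n k j → Set
_≈S_ {n} (S , _) (T , _) = ∀ (v : Vecℤ n) → S v ≡ T v

HasCount : ℕ → ℕ → ℕ → ℕ → Set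
HasCount n k j N = Σ (Fin N → SubringIC n k j) λ f →
    (∀ a b → f a ≈S f b → a ≡ b)
  × (∀ R → ∃ λ a → f a ≈S R)

-- A corank-1 subgroup S of index p^e is the kernel of a functional v ↦ a·v (mod p^e) onto ℤ/p^e;
-- choose t with a·t ≡ 1.  Every ε k = e_k − a_k t lies in S, and ε k ⊙ ε l ∈ S yields, with
-- γ k l = a·(t⊙t) − t_k − t_l,
--   a_k (1 + a_k γ k k) ≡ 0   and   a_k a_l γ k l ≡ 0 for k ≠ l   (mod p^e).
-- Hence each a_k is ≡ 0 or a unit; units k ≠ l force γ k l ≡ 0, so three units k, l, m would give
-- γ k k = γ k l + γ k m − γ l m ≡ 0, contradicting 1 + a_k γ k k ≡ 0.  Since a·t ≡ 1 and a·𝟏 ≡ 0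
-- there are exactly two units a_i ≡ −a_j, and S = {v : v_i ≡ v_j (mod p^e)}.  Conversely each such
-- set is a corank-1 subring of index p^e, and distinct pairs {i, j} give distinct sets.

module Submission where

open import Defs
open import Data.Bool.Properties using (⇔→≡)
open import Data.Empty using (⊥)
open import Data.Fin using (Fin; zero; suc; toℕ; fromℕ; fromℕ<; inject₁; lower₁; splitAt; join; _≟_)
import Data.Fin.Properties as Finₚ
open import Data.Integer using (ℤ; +_; _+_; _-_; _*_; -_; ∣_∣; _%ℕ_; _/ℕ_)
import Data.Integer.DivMod as ℤ
open import Data.Integer.Divisibility.Signed
import Data.Integer.Properties as ℤₚ
open import Data.Integer.Tactic.RingSolver using (solve-∀)
open import Data.Nat as ℕ using (ℕ; zero; suc; _≤_; _<_; _^_; NonZero)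
open import Data.Nat.Combinatorics using (_C_; nC1≡n; nCk+nC[k+1]≡[n+1]C[k+1])
import Data.Nat.Divisibility as ℕ
open import Data.Nat.Primality using (Prime; euclidsLemma; prime⇒nonZero; prime⇒nonTrivial)
import Data.Nat.Properties as ℕₚ
open import Data.Product using (∃; ∃₂; _×_; _,_; proj₁; proj₂)
open import Data.Sum using (_⊎_; inj₁; inj₂)
open import Function using (_∘_; _⇔_; mk⇔; Equivalence)
open Equivalence using (to; from)
import Function.Properties.Equivalence as ⇔
open import Relation.Binary.Definitions using (tri<; tri≈; tri>)
open import Relation.Binary.PropositionalEquality
open import Relation.Nullary using (¬_; Dec; contradiction; does; yes; no; ¬?; _×-dec_)
open import Relation.Nullary.Decidable using (decidable-stable)

open import Algebra.Properties.CommutativeSemigroup ℤₚ.+-commutativeSemigroup using (interchange)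

∣0 : ∀ (d : ℤ) → d ∣ + 0
∣0 d = divides (+ 0) (sym (ℤₚ.*-zeroˡ d))

∣-lincomb : ∀ {d x y z : ℤ} u w → d ∣ x → d ∣ y → u * x + w * y ≡ z → d ∣ z
∣-lincomb u w d∣x d∣y refl = ∣m∣n⇒∣m+n (∣n⇒∣m*n u d∣x) (∣n⇒∣m*n w d∣y)

∣-diff-trans : ∀ {d : ℤ} x y z → d ∣ x - y → d ∣ y - z → d ∣ x - z
∣-diff-trans x y z d∣x-y d∣y-z =
  subst (_ ∣_) (ℤₚ.+-minus-telescope x y z) (∣m∣n⇒∣m+n d∣x-y d∣y-z)

∣-diff-sym : ∀ {d : ℤ} x y → d ∣ x - y → d ∣ y - x
∣-diff-sym x y d∣x-y = subst (_ ∣_) (negate x y) (∣m⇒∣-m d∣x-y)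
  where
  negate : ∀ x y → - (x - y) ≡ y - x
  negate = solve-∀

∣-diff-reflexive : ∀ {d x y : ℤ} → x ≡ y → d ∣ x - y
∣-diff-reflexive {d} {x} refl = subst (d ∣_) (sym (ℤₚ.+-inverseʳ x)) (∣0 d)

∣-diff-zero : ∀ {d x y : ℤ} → y ≡ + 0 → d ∣ x → d ∣ x - y
∣-diff-zero {d} {x} refl = subst (d ∣_) (sym (ℤₚ.+-identityʳ x))

∤1 : ∀ {d} → 1 < d → ¬ + d ∣ + 1
∤1 1<d d∣1 = ℕₚ.<⇒≢ 1<d (sym (ℕ.∣1⇒≡1 (∣⇒∣ᵤ d∣1)))

δ : ∀ {n} → Fin n → Vecℤ n
δ zero    zero    = + 1
δ zero    (suc _) = + 0
δ (suc _) zero    = + 0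
δ (suc i) (suc j) = δ i j

δ-diag : ∀ {n} (i : Fin n) → δ i i ≡ + 1
δ-diag zero    = refl
δ-diag (suc i) = δ-diag i

δ-offdiag : ∀ {n} {i j : Fin n} → i ≢ j → δ i j ≡ + 0
δ-offdiag {i = zero}  {zero}  i≢j = contradiction refl i≢j
δ-offdiag {i = zero}  {suc j} _   = refl
δ-offdiag {i = suc i} {zero}  _   = refl
δ-offdiag {i = suc i} {suc j} i≢j = δ-offdiag (i≢j ∘ cong suc)

infixr 25 _·_

_·_ : ∀ {n} → ℤ → Vecℤ n → Vecℤ n
(c · u) i = c * u i

·δ-diag : ∀ {n} (x : ℤ) (i : Fin n) → (x · δ i) i ≡ x
·δ-diag x i = trans (cong (x *_) (δ-diag i)) (ℤₚ.*-identityʳ x)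

·δ-offdiag : ∀ {n} (x : ℤ) {i k : Fin n} → k ≢ i → (x · δ i) k ≡ + 0
·δ-offdiag x k≢i = trans (cong (x *_) (δ-offdiag (k≢i ∘ sym))) (ℤₚ.*-zeroʳ x)

dot-cong : ∀ {n} (a : Vecℤ n) {u w : Vecℤ n} → u ≗ w → dot a u ≡ dot a w
dot-cong {zero}  a u≗w = refl
dot-cong {suc n} a u≗w = cong₂ _+_ (cong (a zero *_) (u≗w zero)) (dot-cong (a ∘ suc) (u≗w ∘ suc))

dot-⊕ : ∀ {n} (a u w : Vecℤ n) → dot a (u ⊕ w) ≡ dot a u + dot a w
dot-⊕ {zero}  a u w = refl
dot-⊕ {suc n} a u w = begin
  a zero * (u zero + w zero) + dot (a ∘ suc) ((u ⊕ w) ∘ suc)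
    ≡⟨ cong₂ _+_ (ℤₚ.*-distribˡ-+ (a zero) (u zero) (w zero)) (dot-⊕ (a ∘ suc) (u ∘ suc) (w ∘ suc)) ⟩
  (a zero * u zero + a zero * w zero) + (dot (a ∘ suc) (u ∘ suc) + dot (a ∘ suc) (w ∘ suc))
    ≡⟨ interchange (a zero * u zero) (a zero * w zero) _ _ ⟩
  dot a u + dot a w ∎
  where open ≡-Reasoning

dot-· : ∀ {n} (a : Vecℤ n) (c : ℤ) (u : Vecℤ n) → dot a (c · u) ≡ c * dot a u
dot-· {zero}  a c u = sym (ℤₚ.*-zeroʳ c)
dot-· {suc n} a c u = begin
  a zero * (c * u zero) + dot (a ∘ suc) (c · (u ∘ suc))
    ≡⟨ cong₂ _+_ (x[cy]≡c[xy] (a zero) c (u zero)) (dot-· (a ∘ suc) c (u ∘ suc)) ⟩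
  c * (a zero * u zero) + c * dot (a ∘ suc) (u ∘ suc)
    ≡⟨ ℤₚ.*-distribˡ-+ c _ _ ⟨
  c * dot a u ∎
  where
  open ≡-Reasoning
  x[cy]≡c[xy] : ∀ x c y → x * (c * y) ≡ c * (x * y)
  x[cy]≡c[xy] = solve-∀

dot-⊖ : ∀ {n} (a u w : Vecℤ n) → dot a (u ⊖ w) ≡ dot a u - dot a w
dot-⊖ {zero}  a u w = refl
dot-⊖ {suc n} a u w =
  trans (cong (_+_ (a zero * (u zero - w zero))) (dot-⊖ (a ∘ suc) (u ∘ suc) (w ∘ suc)))
        (distrib (a zero) (u zero) (w zero) (dot (a ∘ suc) (u ∘ suc)) (dot (a ∘ suc) (w ∘ suc)))
  where
  distrib : ∀ x y z r s → x * (y - z) + (r - s) ≡ (x * y + r) - (x * z + s)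
  distrib = solve-∀

dot-𝟎 : ∀ {n} (a : Vecℤ n) → dot a 𝟎 ≡ + 0
dot-𝟎 a = trans (dot-· a (+ 0) 𝟏) (ℤₚ.*-zeroˡ (dot a 𝟏))

dot-⊝ : ∀ {n} (a u : Vecℤ n) → dot a (⊝ u) ≡ - dot a u
dot-⊝ {zero}  a u = refl
dot-⊝ {suc n} a u =
  trans (cong (_+_ (a zero * - u zero)) (dot-⊝ (a ∘ suc) (u ∘ suc)))
        (distrib (a zero) (u zero) (dot (a ∘ suc) (u ∘ suc)))
  where
  distrib : ∀ x y r → x * - y + - r ≡ - (x * y + r)
  distrib = solve-∀

dot-δ⊙ : ∀ {n} (a : Vecℤ n) (k : Fin n) (w : Vecℤ n) → dot a (δ k ⊙ w) ≡ a k * w k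
dot-δ⊙ {suc n} a zero w = begin
  a zero * (+ 1 * w zero) + dot (a ∘ suc) ((+ 0) · (w ∘ suc))
    ≡⟨ cong₂ _+_ (cong (a zero *_) (ℤₚ.*-identityˡ (w zero))) (dot-· (a ∘ suc) (+ 0) (w ∘ suc)) ⟩
  a zero * w zero + + 0
    ≡⟨ ℤₚ.+-identityʳ _ ⟩
  a zero * w zero ∎
  where open ≡-Reasoning
dot-δ⊙ {suc n} a (suc k) w = begin
  a zero * (+ 0 * w zero) + dot (a ∘ suc) (δ k ⊙ (w ∘ suc))
    ≡⟨ cong₂ _+_ (ℤₚ.*-zeroʳ (a zero)) (dot-δ⊙ (a ∘ suc) k (w ∘ suc)) ⟩
  + 0 + a (suc k) * w (suc k)
    ≡⟨ ℤₚ.+-identityˡ _ ⟩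
  a (suc k) * w (suc k) ∎
  where open ≡-Reasoning

dot-δ : ∀ {n} (a : Vecℤ n) (k : Fin n) → dot a (δ k) ≡ a k
dot-δ a k = begin
  dot a (δ k)       ≡⟨ dot-cong a (λ m → ℤₚ.*-identityʳ (δ k m)) ⟨
  dot a (δ k ⊙ 𝟏)   ≡⟨ dot-δ⊙ a k 𝟏 ⟩
  a k * + 1         ≡⟨ ℤₚ.*-identityʳ (a k) ⟩
  a k               ∎
  where open ≡-Reasoning

dot-comm : ∀ {n} (a v : Vecℤ n) → dot a v ≡ dot v a
dot-comm {zero}  a v = refl
dot-comm {suc n} a v = cong₂ _+_ (ℤₚ.*-comm (a zero) (v zero)) (dot-comm (a ∘ suc) (v ∘ suc))

∣-dot : ∀ {n} {d : ℤ} (a v : Vecℤ n) → (∀ k → d ∣ a k * v k) → d ∣ dot a v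
∣-dot {zero}  {d} a v _ = ∣0 d
∣-dot {suc n} a v d∣a*v = ∣m∣n⇒∣m+n (d∣a*v zero) (∣-dot (a ∘ suc) (v ∘ suc) (d∣a*v ∘ suc))

dot-congˡ-mod : ∀ {n} {d : ℤ} (a b v : Vecℤ n) → (∀ k → d ∣ a k - b k) → d ∣ dot a v - dot b v
dot-congˡ-mod a b v d∣a-b = subst (_ ∣_) dot-v-a-b
  (∣-dot v (a ⊖ b) (λ k → ∣n⇒∣m*n (v k) (d∣a-b k)))
  where
  dot-v-a-b : dot v (a ⊖ b) ≡ dot a v - dot b v
  dot-v-a-b = trans (dot-⊖ v a b) (cong₂ _-_ (dot-comm v a) (dot-comm v b))

dot-·δ : ∀ {n} (x : ℤ) (i : Fin n) (v : Vecℤ n) → dot (x · δ i) v ≡ x * v i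
dot-·δ x i v = trans (dot-comm (x · δ i) v) (trans (dot-· v x (δ i)) (cong (x *_) (dot-δ v i)))

dot-δ⊖δ : ∀ {n} (i j : Fin n) (v : Vecℤ n) → dot (δ i ⊖ δ j) v ≡ v i - v j
dot-δ⊖δ i j v = begin
  dot (δ i ⊖ δ j) v            ≡⟨ dot-comm (δ i ⊖ δ j) v ⟩
  dot v (δ i ⊖ δ j)            ≡⟨ dot-⊖ v (δ i) (δ j) ⟩
  dot v (δ i) - dot v (δ j)    ≡⟨ cong₂ _-_ (dot-δ v i) (dot-δ v j) ⟩
  v i - v j                    ∎
  where open ≡-Reasoning

module _ {n : ℕ} {d : ℤ} (a v : Vecℤ n) where

  dot≡one-term : ∀ i → (∀ k → k ≢ i → d ∣ a k) → d ∣ dot a v - a i * v i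
  dot≡one-term i d∣others = subst (λ x → d ∣ dot a v - x) (dot-·δ (a i) i v)
    (dot-congˡ-mod a (a i · δ i) v agree)
    where
    agree : ∀ k → d ∣ a k - (a i · δ i) k
    agree k with k ≟ i
    ... | yes refl = ∣-diff-reflexive (sym (·δ-diag (a k) k))
    ... | no k≢i   = ∣-diff-zero (·δ-offdiag (a i) k≢i) (d∣others k k≢i)

  dot≡two-terms : ∀ {i j} → i ≢ j → (∀ k → k ≢ i → k ≢ j → d ∣ a k) →
                  d ∣ dot a v - (a i * v i + a j * v j)
  dot≡two-terms {i} {j} i≢j d∣others =
    subst (λ x → d ∣ dot a v - x) dot-b (dot-congˡ-mod a b v agree)
    where
    b = (a i · δ i) ⊕ (a j · δ j)
    dot-b : dot b v ≡ a i * v i + a j * v j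
    dot-b = begin
      dot b v                                 ≡⟨ dot-comm b v ⟩
      dot v b                                 ≡⟨ dot-⊕ v _ _ ⟩
      dot v (a i · δ i) + dot v (a j · δ j)   ≡⟨ cong₂ _+_ (dot-comm v _) (dot-comm v _) ⟩
      dot (a i · δ i) v + dot (a j · δ j) v   ≡⟨ cong₂ _+_ (dot-·δ (a i) i v) (dot-·δ (a j) j v) ⟩
      a i * v i + a j * v j                   ∎
      where open ≡-Reasoning
    agree : ∀ k → d ∣ a k - b k
    agree k with k ≟ i | k ≟ j
    ... | yes refl | _ = ∣-diff-reflexive (sym
          (trans (cong₂ _+_ (·δ-diag (a k) k) (·δ-offdiag (a j) i≢j)) (ℤₚ.+-identityʳ (a k))))
    ... | no k≢i | yes refl = ∣-diff-reflexive (sym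
          (trans (cong₂ _+_ (·δ-offdiag (a i) k≢i) (·δ-diag (a k) k)) (ℤₚ.+-identityˡ (a k))))
    ... | no k≢i | no k≢j = ∣-diff-zero
          (cong₂ _+_ (·δ-offdiag (a i) k≢i) (·δ-offdiag (a j) k≢j)) (d∣others k k≢i k≢j)

prime-power-cancel : ∀ {p m n} e → Prime p → ¬ p ℕ.∣ m → p ^ e ℕ.∣ m ℕ.* n → p ^ e ℕ.∣ n
prime-power-cancel zero    _       _   _ = ℕ.1∣ _
prime-power-cancel {p} {m} {n} (suc e) p-prime p∤m p^[1+e]∣mn
  with euclidsLemma m n p-prime (ℕ.∣-trans (ℕ.m∣m*n (p ^ e)) p^[1+e]∣mn)
... | inj₁ p∣m = contradiction p∣m p∤m
... | inj₂ (ℕ.divides q refl) =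
  subst (ℕ._∣ q ℕ.* p) (ℕₚ.*-comm (p ^ e) p) (ℕ.*-monoˡ-∣ p p^e∣q)
  where
  instance _ = prime⇒nonZero p-prime
  p[mq]≡m[qp] : p ℕ.* (m ℕ.* q) ≡ m ℕ.* (q ℕ.* p)
  p[mq]≡m[qp] = trans (ℕₚ.*-comm p (m ℕ.* q)) (ℕₚ.*-assoc m q p)
  p^e∣q : p ^ e ℕ.∣ q
  p^e∣q = prime-power-cancel e p-prime p∤m
            (ℕ.*-cancelˡ-∣ p (subst (p ℕ.* p ^ e ℕ.∣_) (sym p[mq]≡m[qp]) p^[1+e]∣mn))

module _ {p : ℕ} (p-prime : Prime p) where

  ∣-prime-power-cancel : ∀ e {x y} → ¬ + p ∣ x → + (p ^ e) ∣ x * y → + (p ^ e) ∣ y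
  ∣-prime-power-cancel e {x} {y} p∤x p^e∣xy = ∣ᵤ⇒∣
    (prime-power-cancel e p-prime (p∤x ∘ ∣ᵤ⇒∣) (subst (p ^ e ℕ.∣_) (ℤₚ.abs-* x y) (∣⇒∣ᵤ p^e∣xy)))

  1<p : 1 < p
  1<p = ℕ.nonTrivial⇒n>1 p {{prime⇒nonTrivial p-prime}}

  1<p^e : ∀ {e} → 1 ≤ e → 1 < p ^ e
  1<p^e {suc e} _ = ℕₚ.<-≤-trans 1<p (ℕₚ.m≤m*n p (p ^ e) {{ℕₚ.m^n≢0 p e {{prime⇒nonZero p-prime}}}})

  p∣p^e : ∀ {e} → 1 ≤ e → + p ∣ + (p ^ e)
  p∣p^e {suc e} _ = ∣ᵤ⇒∣ (ℕ.m∣m*n (p ^ e))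

residue : ∀ {d} .{{_ : NonZero d}} → ℤ → Fin d
residue {d} x = fromℕ< (ℤ.n%ℕd<d x d)

∣-residue : ∀ {d} .{{_ : NonZero d}} x → + d ∣ x - + toℕ (residue {d} x)
∣-residue {d} x = divides (x /ℕ d) (begin
  x - + toℕ (residue {d} x)                 ≡⟨ cong (λ r → x - + r) (Finₚ.toℕ-fromℕ< _) ⟩
  x - + (x %ℕ d)                            ≡⟨ cong (_- + (x %ℕ d)) (ℤ.a≡a%ℕn+[a/ℕn]*n x d) ⟩
  + (x %ℕ d) + (x /ℕ d) * + d - + (x %ℕ d)  ≡⟨ cancel (+ (x %ℕ d)) ((x /ℕ d) * + d) ⟩
  (x /ℕ d) * + d                            ∎)
  where
  open ≡-Reasoning
  cancel : ∀ r q → r + q - r ≡ q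
  cancel = solve-∀

residue-≡⇒∣ : ∀ {d} .{{_ : NonZero d}} x y → residue {d} x ≡ residue y → + d ∣ x - y
residue-≡⇒∣ x y rx≡ry = ∣-diff-trans x _ y (∣-residue x)
  (subst (λ r → _ ∣ + toℕ r - y) (sym rx≡ry) (∣-diff-sym y _ (∣-residue y)))

residue-unique : ∀ {d c c'} → c < d → c' < d → + d ∣ + c - + c' → c ≡ c'
residue-unique {d} {c} {c'} c<d c'<d d∣c-c' =
  ℤₚ.+-injective (ℤₚ.i-j≡0⇒i≡j (+ c) (+ c') (ℤₚ.∣i∣≡0⇒i≡0 ∣c-c'∣≡0))
  where
  ∣c-c'∣<d : ∣ + c - + c' ∣ < d
  ∣c-c'∣<d = subst (_< d) (cong ∣_∣ (sym (ℤₚ.m-n≡m⊖n c c')))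
               (ℕₚ.≤-<-trans (ℤₚ.∣m⊝n∣≤m⊔n c c') (ℕₚ.⊔-lub c<d c'<d))
  ∣c-c'∣≡0 : ∣ + c - + c' ∣ ≡ 0
  ∣c-c'∣≡0 with ∣ + c - + c' ∣ | ∣⇒∣ᵤ d∣c-c' | ∣c-c'∣<d
  ... | zero  | _   | _ = refl
  ... | suc _ | d∣m | m<d = contradiction (ℕ.∣⇒≤ d∣m) (ℕₚ.<⇒≱ m<d)

record IsKernelMod {n} (S : Subset n) (a : Vecℤ n) (d : ℕ) : Set where
  field
    sound    : ∀ v → v ∈ S → + d ∣ dot a v
    complete : ∀ v → + d ∣ dot a v → v ∈ S
    onto     : ∀ z → ∃ λ v → + d ∣ dot a v - z

module _ {n : ℕ} {S : Subset n} {a : Vecℤ n} {d : ℕ} (K : IsKernelMod S a d) where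
  open IsKernelMod K

  preimage : ℤ → Vecℤ n
  preimage z = proj₁ (onto z)

  ∣-preimage : ∀ z → + d ∣ dot a (preimage z) - z
  ∣-preimage z = proj₂ (onto z)

  ≡mod⇒⊖∈ : ∀ u w → + d ∣ dot a u - dot a w → (u ⊖ w) ∈ S
  ≡mod⇒⊖∈ u w d∣au-aw = complete (u ⊖ w) (subst (+ d ∣_) (sym (dot-⊖ a u w)) d∣au-aw)

  ⊖∈⇒≡mod : ∀ u w → (u ⊖ w) ∈ S → + d ∣ dot a u - dot a w
  ⊖∈⇒≡mod u w u-w∈S = subst (+ d ∣_) (dot-⊖ a u w) (sound (u ⊖ w) u-w∈S)

  kernelMod⇒subgroup : IsSubgroup S
  kernelMod⇒subgroup =
      complete 𝟎 (subst (+ d ∣_) (sym (dot-𝟎 a)) (∣0 (+ d)))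
    , (λ u w u∈S w∈S → complete (u ⊕ w)
        (subst (+ d ∣_) (sym (dot-⊕ a u w)) (∣m∣n⇒∣m+n (sound u u∈S) (sound w w∈S))))
    , (λ u u∈S → complete (⊝ u) (subst (+ d ∣_) (sym (dot-⊝ a u)) (∣m⇒∣-m (sound u u∈S))))

  kernelMod⇒corank1 : 1 < d → HasCorank S 1
  kernelMod⇒corank1 1<d = (λ _ → d) , (λ _ → 1<d) , (λ _ _ _ → ℕ.∣-refl) , (λ _ → a)
    , (λ v v∈S _ → ∣⇒∣ᵤ (sound v v∈S))
    , (λ v d∣av → complete v (∣ᵤ⇒∣ (d∣av zero)))
    , (λ w → preimage (w zero) , λ { zero → ∣⇒∣ᵤ (∣-preimage (w zero)) })

  module _ .{{_ : NonZero d}} where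

    kernelMod⇒index : HasIndex S d
    kernelMod⇒index = representative , distinct , covering
      where
      representative : Fin d → Vecℤ n
      representative c = preimage (+ toℕ c)
      distinct : ∀ c c' → (representative c ⊖ representative c') ∈ S → c ≡ c'
      distinct c c' r-r'∈S = Finₚ.toℕ-injective (residue-unique (Finₚ.toℕ<n c) (Finₚ.toℕ<n c')
        (∣-diff-trans (+ toℕ c) (dot a r) (+ toℕ c')
          (∣-diff-sym (dot a r) (+ toℕ c) (∣-preimage (+ toℕ c)))
          (∣-diff-trans (dot a r) (dot a r') (+ toℕ c') (⊖∈⇒≡mod _ _ r-r'∈S) (∣-preimage (+ toℕ c')))))
        where
        r = representative c
        r' = representative c'
      covering : ∀ v → ∃ λ c → (v ⊖ representative c) ∈ S
      covering v = c , ≡mod⇒⊖∈ v r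
        (∣-diff-trans (dot a v) (+ toℕ c) (dot a r) (∣-residue (dot a v))
          (∣-diff-sym (dot a r) (+ toℕ c) (∣-preimage (+ toℕ c))))
        where
        c = residue (dot a v)
        r = representative c

    kernelMod-index-unique : ∀ {N} → HasIndex S N → N ≡ d
    kernelMod-index-unique {N} (r , distinct , covering) =
      ℕₚ.≤-antisym (Finₚ.injective⇒≤ residue-injective) (Finₚ.injective⇒≤ class-injective)
      where
      residue-injective : ∀ {i j} → residue (dot a (r i)) ≡ residue (dot a (r j)) → i ≡ j
      residue-injective {i} {j} eq =
        distinct i j (≡mod⇒⊖∈ (r i) (r j) (residue-≡⇒∣ (dot a (r i)) (dot a (r j)) eq))
      class : Fin d → Fin N
      class c = proj₁ (covering (preimage (+ toℕ c)))
      class-injective : ∀ {c c'} → class c ≡ class c' → c ≡ c'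
      class-injective {c} {c'} eq =
        Finₚ.toℕ-injective (residue-unique (Finₚ.toℕ<n c) (Finₚ.toℕ<n c') d∣c-c')
        where
        v = preimage (+ toℕ c)
        v' = preimage (+ toℕ c')
        ri = r (class c)
        v∼ri : + d ∣ dot a v - dot a ri
        v∼ri = ⊖∈⇒≡mod v ri (proj₂ (covering v))
        v'∼ri : + d ∣ dot a v' - dot a ri
        v'∼ri = ⊖∈⇒≡mod v' ri (subst (λ i → (v' ⊖ r i) ∈ S) (sym eq) (proj₂ (covering v')))
        d∣c-c' : + d ∣ + toℕ c - + toℕ c'
        d∣c-c' = ∣-diff-trans (+ toℕ c) (dot a v) (+ toℕ c')
          (∣-diff-sym (dot a v) (+ toℕ c) (∣-preimage (+ toℕ c)))
          (∣-diff-trans (dot a v) (dot a ri) (+ toℕ c') v∼ri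
            (∣-diff-trans (dot a ri) (dot a v') (+ toℕ c')
              (∣-diff-sym (dot a v') (dot a ri) v'∼ri) (∣-preimage (+ toℕ c'))))

corank1⇒kernelMod : ∀ {n N} {S : Subset n} → HasIndex S N → HasCorank S 1 → ∃ λ a → IsKernelMod S a N
corank1⇒kernelMod {S = S} index (d , 1<d , _ , A , sound , complete , onto) =
  A zero , subst (IsKernelMod S (A zero)) (sym (kernelMod-index-unique K {{d₀≢0}} index)) K
  where
  K : IsKernelMod S (A zero) (d zero)
  K = record
    { sound    = λ v v∈S → ∣ᵤ⇒∣ (sound v v∈S zero)
    ; complete = λ v d∣Av → complete v λ { zero → ∣⇒∣ᵤ d∣Av }
    ; onto     = λ z → proj₁ (onto λ _ → z) , ∣ᵤ⇒∣ (proj₂ (onto λ _ → z) zero)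
    }
  d₀≢0 : NonZero (d zero)
  d₀≢0 = ℕ.>-nonZero (ℕₚ.<-trans (ℕ.s≤s ℕ.z≤n) (1<d zero))

Δ : ∀ {n} → ℕ → Fin n → Fin n → Subset n
Δ d i j v = does (d ℕ.∣? ∣ v i - v j ∣)

∈Δ⇔ : ∀ {n} d (i j : Fin n) v → v ∈ Δ d i j ⇔ + d ∣ v i - v j
∈Δ⇔ d i j v with d ℕ.∣? ∣ v i - v j ∣
... | yes d∣ = mk⇔ (λ _ → ∣ᵤ⇒∣ d∣) (λ _ → refl)
... | no d∤ = mk⇔ (λ ()) (λ d∣ → contradiction (∣⇒∣ᵤ d∣) d∤)

Δ≗ : ∀ {n d} {k l : Fin n} {S : Subset n} → (∀ v → (v ∈ S) ⇔ (+ d ∣ v k - v l)) → Δ d k l ≗ S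
Δ≗ {d = d} {k} {l} S⇔ v = ⇔→≡ (⇔.trans (∈Δ⇔ d k l v) (⇔.sym (S⇔ v)))

module _ {n d : ℕ} {i j : Fin n} (i≢j : i ≢ j) where

  Δ-kernelMod : IsKernelMod (Δ d i j) (δ i ⊖ δ j) d
  Δ-kernelMod = record
    { sound    = λ v v∈Δ → subst (+ d ∣_) (sym (dot-δ⊖δ i j v)) (to (∈Δ⇔ d i j v) v∈Δ)
    ; complete = λ v d∣ → from (∈Δ⇔ d i j v) (subst (+ d ∣_) (dot-δ⊖δ i j v) d∣)
    ; onto     = λ z → z · δ i , ∣-diff-reflexive (z·δᵢ↦z z)
    }
    where
    z·δᵢ↦z : ∀ z → dot (δ i ⊖ δ j) (z · δ i) ≡ z
    z·δᵢ↦z z = begin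
      dot (δ i ⊖ δ j) (z · δ i)    ≡⟨ dot-δ⊖δ i j (z · δ i) ⟩
      (z · δ i) i - (z · δ i) j    ≡⟨ cong₂ _-_ (·δ-diag z i) (·δ-offdiag z (i≢j ∘ sym)) ⟩
      z - + 0                      ≡⟨ ℤₚ.+-identityʳ z ⟩
      z                            ∎
      where open ≡-Reasoning

  Δ-⊙-closed : ∀ u w → u ∈ Δ d i j → w ∈ Δ d i j → (u ⊙ w) ∈ Δ d i j
  Δ-⊙-closed u w u∈Δ w∈Δ = from (∈Δ⇔ d i j (u ⊙ w))
    (∣-lincomb (w i) (u j) (to (∈Δ⇔ d i j u) u∈Δ) (to (∈Δ⇔ d i j w) w∈Δ)
      (expand (u i) (u j) (w i) (w j)))
    where
    expand : ∀ ui uj wi wj → wi * (ui - uj) + uj * (wi - wj) ≡ ui * wi - uj * wj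
    expand = solve-∀

  𝟏∈Δ : 𝟏 ∈ Δ d i j
  𝟏∈Δ = from (∈Δ⇔ d i j 𝟏) (∣0 (+ d))

  diagonalSubring : 1 < d → SubringIC n 1 d
  diagonalSubring 1<d = Δ d i j
    , (kernelMod⇒subgroup Δ-kernelMod , (d , kernelMod⇒index Δ-kernelMod) , Δ-⊙-closed , 𝟏∈Δ)
    , kernelMod⇒index Δ-kernelMod
    , kernelMod⇒corank1 Δ-kernelMod 1<d
    where instance _ = ℕ.>-nonZero (ℕₚ.<-trans (ℕ.s≤s ℕ.z≤n) 1<d)

module _ {n d : ℕ} (1<d : 1 < d) where

  δ∈Δ : ∀ {m k l : Fin n} → m ≢ k → m ≢ l → δ m ∈ Δ d k l
  δ∈Δ {m} {k} {l} m≢k m≢l =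
    from (∈Δ⇔ d k l (δ m)) (∣-diff-reflexive (trans (δ-offdiag m≢k) (sym (δ-offdiag m≢l))))

  δ∉Δ : ∀ {m k l : Fin n} → k ≢ l → m ≡ k ⊎ m ≡ l → ¬ δ m ∈ Δ d k l
  δ∉Δ {k = k} {l} k≢l (inj₁ refl) δₖ∈Δ = ∤1 1<d
    (subst₂ (λ x y → + d ∣ x - y) (δ-diag k) (δ-offdiag k≢l) (to (∈Δ⇔ d k l (δ k)) δₖ∈Δ))
  δ∉Δ {k = k} {l} k≢l (inj₂ refl) δₗ∈Δ = ∤1 1<d (∣m⇒∣-m
    (subst₂ (λ x y → + d ∣ x - y) (δ-offdiag (k≢l ∘ sym)) (δ-diag l) (to (∈Δ⇔ d k l (δ l)) δₗ∈Δ)))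

  Δ-endpoints : ∀ {i j k l : Fin n} → i ≢ j → Δ d i j ≗ Δ d k l → ∀ {m} → m ≡ i ⊎ m ≡ j → m ≡ k ⊎ m ≡ l
  Δ-endpoints {k = k} {l} i≢j Δij≗Δkl {m} m∈ij with m ≟ k | m ≟ l
  ... | yes m≡k | _       = inj₁ m≡k
  ... | no _    | yes m≡l = inj₂ m≡l
  ... | no m≢k  | no m≢l  = contradiction (trans (Δij≗Δkl (δ m)) (δ∈Δ m≢k m≢l)) (δ∉Δ i≢j m∈ij)

  Δ-injective : ∀ {i j k l : Fin n} → toℕ i < toℕ j → toℕ k < toℕ l → Δ d i j ≗ Δ d k l → i ≡ k × j ≡ l
  Δ-injective {i} {j} i<j k<l Δij≗Δkl
    with Δ-endpoints i≢j Δij≗Δkl (inj₁ refl) | Δ-endpoints i≢j Δij≗Δkl (inj₂ refl)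
    where i≢j = ℕₚ.<⇒≢ i<j ∘ cong toℕ
  ... | inj₁ i≡k  | inj₂ j≡l  = i≡k , j≡l
  ... | inj₁ refl | inj₁ refl = contradiction i<j (ℕₚ.<-irrefl refl)
  ... | inj₂ refl | inj₂ refl = contradiction i<j (ℕₚ.<-irrefl refl)
  ... | inj₂ refl | inj₁ refl = contradiction i<j (ℕₚ.<-asym k<l)

orient : ∀ {n} {d : ℤ} {P : Vecℤ n → Set} {i j : Fin n} → i ≢ j → (∀ v → P v ⇔ (d ∣ v i - v j)) →
         ∃₂ λ k l → toℕ k < toℕ l × (∀ v → P v ⇔ (d ∣ v k - v l))
orient {i = i} {j} i≢j P⇔ with ℕₚ.<-cmp (toℕ i) (toℕ j)
... | tri< i<j _ _ = i , j , i<j , P⇔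
... | tri≈ _ i≡j _ = contradiction (Finₚ.toℕ-injective i≡j) i≢j
... | tri> _ _ j<i = j , i , j<i ,
  λ v → ⇔.trans (P⇔ v) (mk⇔ (∣-diff-sym (v i) (v j)) (∣-diff-sym (v j) (v i)))

module SubringKernel {n p e : ℕ} (p-prime : Prime p) (e≥1 : 1 ≤ e) {S : Subset n} {a : Vecℤ n}
  (K : IsKernelMod S a (p ^ e)) (⊙-closed : ∀ u w → u ∈ S → w ∈ S → (u ⊙ w) ∈ S) (𝟏∈S : 𝟏 ∈ S)
  where

  open IsKernelMod K

  private
    D : ℤ
    D = + (p ^ e)

    t : Vecℤ n
    t = preimage K (+ 1)

    t-hits-1 : D ∣ dot a t - + 1
    t-hits-1 = ∣-preimage K (+ 1)

    𝟏-kernel : D ∣ dot a 𝟏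
    𝟏-kernel = sound 𝟏 𝟏∈S

    γ : Fin n → Fin n → ℤ
    γ k l = dot a (t ⊙ t) - t k - t l

  ε : Fin n → Vecℤ n
  ε k = δ k ⊖ (a k · t)

  ε-kernel : ∀ k → D ∣ dot a (ε k)
  ε-kernel k = subst (D ∣_) (sym dot-ε) (∣n⇒∣m*n (- a k) t-hits-1)
    where
    factor : ∀ x y → x - x * y ≡ - x * (y - + 1)
    factor = solve-∀
    dot-ε : dot a (ε k) ≡ - a k * (dot a t - + 1)
    dot-ε = begin
      dot a (ε k)                      ≡⟨ dot-⊖ a (δ k) (a k · t) ⟩
      dot a (δ k) - dot a (a k · t)    ≡⟨ cong₂ _-_ (dot-δ a k) (dot-· a (a k) t) ⟩
      a k - a k * dot a t              ≡⟨ factor (a k) (dot a t) ⟩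
      - a k * (dot a t - + 1)          ∎
      where open ≡-Reasoning

  dot-ε⊙ : ∀ k w → dot a (ε k ⊙ w) ≡ a k * (w k - dot a (t ⊙ w))
  dot-ε⊙ k w = begin
    dot a (ε k ⊙ w)                            ≡⟨ dot-cong a (λ m → distrib (δ k m) (a k) (t m) (w m)) ⟩
    dot a ((δ k ⊙ w) ⊖ (a k · (t ⊙ w)))        ≡⟨ dot-⊖ a (δ k ⊙ w) (a k · (t ⊙ w)) ⟩
    dot a (δ k ⊙ w) - dot a (a k · (t ⊙ w))    ≡⟨ cong₂ _-_ (dot-δ⊙ a k w) (dot-· a (a k) (t ⊙ w)) ⟩
    a k * w k - a k * dot a (t ⊙ w)            ≡⟨ factor (a k) (w k) (dot a (t ⊙ w)) ⟩
    a k * (w k - dot a (t ⊙ w))                ∎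
    where
    open ≡-Reasoning
    distrib : ∀ δ x τ ω → (δ - x * τ) * ω ≡ δ * ω - x * (τ * ω)
    distrib = solve-∀
    factor : ∀ x y z → x * y - x * z ≡ x * (y - z)
    factor = solve-∀

  dot-ε⊙ε : ∀ k l → dot a (ε k ⊙ ε l) ≡ a k * δ l k + a k * a l * γ k l
  dot-ε⊙ε k l = begin
    dot a (ε k ⊙ ε l)                                ≡⟨ dot-ε⊙ k (ε l) ⟩
    a k * (ε l k - dot a (t ⊙ ε l))                  ≡⟨ cong (λ x → a k * (ε l k - x)) dot-t⊙εₗ ⟩
    a k * (ε l k - a l * (t l - dot a (t ⊙ t)))      ≡⟨ collect (a k) (a l) (δ l k) (t k) (t l) (dot a (t ⊙ t)) ⟩
    a k * δ l k + a k * a l * γ k l                  ∎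
    where
    open ≡-Reasoning
    dot-t⊙εₗ : dot a (t ⊙ ε l) ≡ a l * (t l - dot a (t ⊙ t))
    dot-t⊙εₗ = trans (dot-cong a (λ m → ℤₚ.*-comm (t m) (ε l m))) (dot-ε⊙ l t)
    collect : ∀ x y δ τ σ c → x * ((δ - y * τ) - y * (σ - c)) ≡ x * δ + x * y * (c - τ - σ)
    collect = solve-∀

  product-relation : ∀ k l → D ∣ a k * δ l k + a k * a l * γ k l
  product-relation k l = subst (D ∣_) (dot-ε⊙ε k l)
    (sound (ε k ⊙ ε l) (⊙-closed (ε k) (ε l) (complete (ε k) (ε-kernel k)) (complete (ε l) (ε-kernel l))))

  diagonal-relation : ∀ k → D ∣ a k * (+ 1 + a k * γ k k)
  diagonal-relation k = subst (D ∣_)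
    (trans (cong (λ x → a k * x + a k * a k * γ k k) (δ-diag k)) (factor (a k) (γ k k)))
    (product-relation k k)
    where
    factor : ∀ x y → x * + 1 + x * x * y ≡ x * (+ 1 + x * y)
    factor = solve-∀

  offdiagonal-relation : ∀ {k l} → k ≢ l → D ∣ a k * (a l * γ k l)
  offdiagonal-relation {k} {l} k≢l = subst (D ∣_)
    (trans (cong (λ x → a k * x + a k * a l * γ k l) (δ-offdiag (k≢l ∘ sym))) (factor (a k) (a l) (γ k l)))
    (product-relation k l)
    where
    factor : ∀ x y z → x * + 0 + x * y * z ≡ x * (y * z)
    factor = solve-∀

  Unit : Fin n → Set
  Unit k = ¬ + p ∣ a k

  unit? : ∀ k → Dec (Unit k)
  unit? k = ¬? (+ p ∣? a k)

  nonunit⇒p∣ : ∀ {k} → ¬ Unit k → + p ∣ a k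
  nonunit⇒p∣ {k} = decidable-stable (+ p ∣? a k)

  nonunit⇒D∣ : ∀ {k} → ¬ Unit k → D ∣ a k
  nonunit⇒D∣ {k} ¬uₖ =
    ∣-prime-power-cancel p-prime e p∤1+aₖγₖₖ (subst (D ∣_) (ℤₚ.*-comm (a k) _) (diagonal-relation k))
    where
    p∤1+aₖγₖₖ : ¬ + p ∣ + 1 + a k * γ k k
    p∤1+aₖγₖₖ p∣ = ∤1 (1<p p-prime)
      (∣-lincomb (+ 1) (- γ k k) p∣ (nonunit⇒p∣ ¬uₖ) (restore (a k) (γ k k)))
      where
      restore : ∀ x y → + 1 * (+ 1 + x * y) + - y * x ≡ + 1
      restore = solve-∀

  unit⇒aₖγₖₖ≡-1 : ∀ {k} → Unit k → D ∣ + 1 + a k * γ k k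
  unit⇒aₖγₖₖ≡-1 {k} uₖ = ∣-prime-power-cancel p-prime e uₖ (diagonal-relation k)

  units⇒γₖₗ≡0 : ∀ {k l} → k ≢ l → Unit k → Unit l → D ∣ γ k l
  units⇒γₖₗ≡0 k≢l uₖ uₗ =
    ∣-prime-power-cancel p-prime e uₗ (∣-prime-power-cancel p-prime e uₖ (offdiagonal-relation k≢l))

  no-three-units : ∀ {k l m} → k ≢ l → k ≢ m → l ≢ m → Unit k → Unit l → Unit m → ⊥
  no-three-units {k} {l} {m} k≢l k≢m l≢m uₖ uₗ uₘ = ∤1 (1<p^e p-prime e≥1)
    (∣-lincomb (+ 1) (- a k) (unit⇒aₖγₖₖ≡-1 uₖ) D∣γₖₖ (restore (a k) (γ k k)))
    where
    γₖₖ≡γₖₗ+γₖₘ-γₗₘ : γ k l + γ k m - γ l m ≡ γ k k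
    γₖₖ≡γₖₗ+γₖₘ-γₗₘ = telescope (dot a (t ⊙ t)) (t k) (t l) (t m)
      where
      telescope : ∀ c τ σ ρ → (c - τ - σ) + (c - τ - ρ) - (c - σ - ρ) ≡ c - τ - τ
      telescope = solve-∀
    D∣γₖₖ : D ∣ γ k k
    D∣γₖₖ = subst (D ∣_) γₖₖ≡γₖₗ+γₖₘ-γₗₘ
      (∣m∣n⇒∣m-n (∣m∣n⇒∣m+n (units⇒γₖₗ≡0 k≢l uₖ uₗ) (units⇒γₖₗ≡0 k≢m uₖ uₘ)) (units⇒γₖₗ≡0 l≢m uₗ uₘ))
    restore : ∀ x y → + 1 * (+ 1 + x * y) + - x * y ≡ + 1
    restore = solve-∀

  some-unit : ∃ Unit
  some-unit with Finₚ.any? unit?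
  ... | yes ∃u = ∃u
  ... | no ∄u = contradiction p∣1 (∤1 (1<p p-prime))
    where
    p∣a·t : + p ∣ dot a t
    p∣a·t = ∣-dot a t (λ k → ∣m⇒∣m*n (t k) (nonunit⇒p∣ (∄u ∘ (k ,_))))
    p∣1 : + p ∣ + 1
    p∣1 = ∣-lincomb (+ 1) (- + 1) p∣a·t (∣-trans (p∣p^e p-prime e≥1) t-hits-1) (restore (dot a t))
      where
      restore : ∀ x → + 1 * x + - + 1 * (x - + 1) ≡ + 1
      restore = solve-∀

  another-unit : ∀ {i} → Unit i → ∃ λ j → j ≢ i × Unit j
  another-unit {i} uᵢ with Finₚ.any? (λ j → ¬? (j ≟ i) ×-dec unit? j)
  ... | yes ∃u = ∃u
  ... | no ∄u = contradiction (∣-trans (p∣p^e p-prime e≥1) D∣aᵢ) uᵢ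
    where
    D∣aᵢ : D ∣ a i
    D∣aᵢ = ∣-lincomb (+ 1) (- + 1) 𝟏-kernel
      (dot≡one-term a 𝟏 i (λ k k≢i → nonunit⇒D∣ (λ uₖ → ∄u (k , k≢i , uₖ))))
      (isolate (dot a 𝟏) (a i))
      where
      isolate : ∀ x y → + 1 * x + - + 1 * (x - y * + 1) ≡ y
      isolate = solve-∀

  diagonal : ∃₂ λ i j → i ≢ j × (∀ v → (v ∈ S) ⇔ (D ∣ v i - v j))
  diagonal = i , j , j≢i ∘ sym ,
    λ v → mk⇔ (kernel⇒diagonal v ∘ sound v) (complete v ∘ diagonal⇒kernel v)
    where
    i = proj₁ some-unit
    uᵢ = proj₂ some-unit
    j = proj₁ (another-unit uᵢ)
    j≢i = proj₁ (proj₂ (another-unit uᵢ))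
    uⱼ = proj₂ (proj₂ (another-unit uᵢ))

    others-vanish : ∀ k → k ≢ i → k ≢ j → D ∣ a k
    others-vanish k k≢i k≢j = nonunit⇒D∣ (no-three-units (j≢i ∘ sym) (k≢i ∘ sym) (k≢j ∘ sym) uᵢ uⱼ)

    dot≡aᵢvᵢ+aⱼvⱼ : ∀ v → D ∣ dot a v - (a i * v i + a j * v j)
    dot≡aᵢvᵢ+aⱼvⱼ v = dot≡two-terms a v (j≢i ∘ sym) others-vanish

    aᵢ+aⱼ≡0 : D ∣ a i + a j
    aᵢ+aⱼ≡0 = ∣-lincomb (+ 1) (- + 1) 𝟏-kernel (dot≡aᵢvᵢ+aⱼvⱼ 𝟏) (isolate (dot a 𝟏) (a i) (a j))
      where
      isolate : ∀ x y z → + 1 * x + - + 1 * (x - (y * + 1 + z * + 1)) ≡ y + z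
      isolate = solve-∀

    dot≡aᵢ[vᵢ-vⱼ] : ∀ v → D ∣ dot a v - a i * (v i - v j)
    dot≡aᵢ[vᵢ-vⱼ] v =
      ∣-lincomb (+ 1) (v j) (dot≡aᵢvᵢ+aⱼvⱼ v) aᵢ+aⱼ≡0 (regroup (dot a v) (a i) (a j) (v i) (v j))
      where
      regroup : ∀ x y z y' z' → + 1 * (x - (y * y' + z * z')) + z' * (y + z) ≡ x - y * (y' - z')
      regroup = solve-∀

    kernel⇒diagonal : ∀ v → D ∣ dot a v → D ∣ v i - v j
    kernel⇒diagonal v D∣av = ∣-prime-power-cancel p-prime e uᵢ
      (∣-lincomb (+ 1) (- + 1) D∣av (dot≡aᵢ[vᵢ-vⱼ] v) (isolate (dot a v) (a i * (v i - v j))))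
      where
      isolate : ∀ x y → + 1 * x + - + 1 * (x - y) ≡ y
      isolate = solve-∀

    diagonal⇒kernel : ∀ v → D ∣ v i - v j → D ∣ dot a v
    diagonal⇒kernel v D∣vᵢ-vⱼ =
      ∣-lincomb (+ 1) (a i) (dot≡aᵢ[vᵢ-vⱼ] v) D∣vᵢ-vⱼ (restore (dot a v) (a i * (v i - v j)))
      where
      restore : ∀ x y → + 1 * (x - y) + y ≡ x
      restore = solve-∀

corank1-subring-diagonal : ∀ {n p e} {S : Subset n} → Prime p → 1 ≤ e →
  IsSubring S → HasIndex S (p ^ e) → HasCorank S 1 →
  ∃₂ λ i j → toℕ i < toℕ j × (∀ v → (v ∈ S) ⇔ (+ (p ^ e) ∣ v i - v j))
corank1-subring-diagonal p-prime e≥1 (_ , _ , ⊙-closed , 𝟏∈S) index corank =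
  let i , j , i≢j , S⇔Δᵢⱼ = SubringKernel.diagonal p-prime e≥1 (proj₂ (corank1⇒kernelMod index corank)) ⊙-closed 𝟏∈S
  in orient i≢j S⇔Δᵢⱼ

triangle : ℕ → ℕ
triangle zero    = 0
triangle (suc n) = n ℕ.+ triangle n

nC2≡triangle : ∀ n → n C 2 ≡ triangle n
nC2≡triangle zero    = refl
nC2≡triangle (suc n) =
  trans (sym (nCk+nC[k+1]≡[n+1]C[k+1] n 1)) (cong₂ ℕ._+_ (nC1≡n n) (nC2≡triangle n))

pair : ∀ n → Fin (triangle n) → Fin n × Fin n
pair-step : ∀ n → Fin n ⊎ Fin (triangle n) → Fin (suc n) × Fin (suc n)

pair (suc n) x = pair-step n (splitAt n x)

pair-step n (inj₁ i) = inject₁ i , fromℕ n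
pair-step n (inj₂ y) = inject₁ (proj₁ (pair n y)) , inject₁ (proj₂ (pair n y))

pair-increasing : ∀ n x → toℕ (proj₁ (pair n x)) < toℕ (proj₂ (pair n x))
pair-increasing (suc n) x with splitAt n x
... | inj₁ i rewrite Finₚ.toℕ-inject₁ i | Finₚ.toℕ-fromℕ n = Finₚ.toℕ<n i
... | inj₂ y rewrite Finₚ.toℕ-inject₁ (proj₁ (pair n y)) | Finₚ.toℕ-inject₁ (proj₂ (pair n y)) =
  pair-increasing n y

pair-injective : ∀ n {x y} → pair n x ≡ pair n y → x ≡ y
pair-step-injective : ∀ n {x y} → pair-step n x ≡ pair-step n y → x ≡ y

pair-injective (suc n) {x} {y} eq = begin
  x                        ≡⟨ Finₚ.join-splitAt n (triangle n) x ⟨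
  join n _ (splitAt n x)   ≡⟨ cong (join n _) (pair-step-injective n eq) ⟩
  join n _ (splitAt n y)   ≡⟨ Finₚ.join-splitAt n (triangle n) y ⟩
  y                        ∎
  where open ≡-Reasoning

pair-step-injective n {inj₁ i} {inj₁ i'} eq = cong inj₁ (Finₚ.inject₁-injective (cong proj₁ eq))
pair-step-injective n {inj₁ i} {inj₂ y'} eq = contradiction (cong proj₂ eq) Finₚ.fromℕ≢inject₁
pair-step-injective n {inj₂ y} {inj₁ i'} eq = contradiction (sym (cong proj₂ eq)) Finₚ.fromℕ≢inject₁
pair-step-injective n {inj₂ y} {inj₂ y'} eq = cong inj₂ (pair-injective n (cong₂ _,_
  (Finₚ.inject₁-injective (cong proj₁ eq)) (Finₚ.inject₁-injective (cong proj₂ eq))))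

pair-surjective : ∀ n {i j : Fin n} → toℕ i < toℕ j → ∃ λ x → pair n x ≡ (i , j)
pair-surjective (suc n) {i} {j} i<j with toℕ j ℕₚ.≟ n
... | yes j≡n = join n _ (inj₁ i') , (begin
  pair-step n (splitAt n (join n _ (inj₁ i')))
    ≡⟨ cong (pair-step n) (Finₚ.splitAt-join n _ (inj₁ i')) ⟩
  inject₁ i' , fromℕ n
    ≡⟨ cong₂ _,_ (Finₚ.inject₁-lower₁ i n≢i) (Finₚ.toℕ-injective (trans (Finₚ.toℕ-fromℕ n) (sym j≡n))) ⟩
  i , j ∎)
  where
  open ≡-Reasoning
  n≢i : n ≢ toℕ i
  n≢i n≡i = ℕₚ.<⇒≢ i<j (trans (sym n≡i) (sym j≡n))
  i' = lower₁ i n≢i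
... | no j≢n = join n _ (inj₂ y) , (begin
  pair-step n (splitAt n (join n _ (inj₂ y)))
    ≡⟨ cong (pair-step n) (Finₚ.splitAt-join n _ (inj₂ y)) ⟩
  inject₁ (proj₁ (pair n y)) , inject₁ (proj₂ (pair n y))
    ≡⟨ cong (λ (k , l) → inject₁ k , inject₁ l) pair-y≡i'j' ⟩
  inject₁ i' , inject₁ j'
    ≡⟨ cong₂ _,_ (Finₚ.inject₁-lower₁ i n≢i) (Finₚ.inject₁-lower₁ j n≢j) ⟩
  i , j ∎)
  where
  open ≡-Reasoning
  n≢j : n ≢ toℕ j
  n≢j = j≢n ∘ sym
  j<n : toℕ j < n
  j<n = ℕₚ.≤∧≢⇒< (ℕ.s≤s⁻¹ (Finₚ.toℕ<n j)) j≢n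
  n≢i : n ≢ toℕ i
  n≢i n≡i = ℕₚ.<-asym i<j (subst (toℕ j <_) n≡i j<n)
  i' = lower₁ i n≢i
  j' = lower₁ j n≢j
  i'<j' : toℕ i' < toℕ j'
  i'<j' = subst₂ _<_ (sym (Finₚ.toℕ-lower₁ i n≢i)) (sym (Finₚ.toℕ-lower₁ j n≢j)) i<j
  y = proj₁ (pair-surjective n i'<j')
  pair-y≡i'j' = proj₂ (pair-surjective n i'<j')

module _ {p : ℕ} (p-prime : Prime p) {e : ℕ} (e≥1 : 1 ≤ e) (n : ℕ) where

  diagonalSubringAt : Fin (triangle n) → SubringIC n 1 (p ^ e)
  diagonalSubringAt x = diagonalSubring (ℕₚ.<⇒≢ (pair-increasing n x) ∘ cong toℕ) (1<p^e p-prime e≥1)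

  diagonalSubringAt-injective : ∀ x y → diagonalSubringAt x ≈S diagonalSubringAt y → x ≡ y
  diagonalSubringAt-injective x y Δx≗Δy = pair-injective n (cong₂ _,_ i≡k j≡l)
    where
    i≡k×j≡l = Δ-injective (1<p^e p-prime e≥1) (pair-increasing n x) (pair-increasing n y) Δx≗Δy
    i≡k = proj₁ i≡k×j≡l
    j≡l = proj₂ i≡k×j≡l

  diagonalSubringAt-surjective : ∀ R → ∃ λ x → diagonalSubringAt x ≈S R
  diagonalSubringAt-surjective (S , subring , index , corank) =
    let k , l , k<l , S⇔Δₖₗ = corank1-subring-diagonal p-prime e≥1 subring index corank
        x , pairₓ≡kl = pair-surjective n k<l
    in x , subst (λ (k , l) → Δ (p ^ e) k l ≗ S) (sym pairₓ≡kl) (Δ≗ S⇔Δₖₗ)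

-- The hypothesis 2 ≤ n is unused: for n < 2 both sides of the count are 0.
proposition3p2 : (p : ℕ) → Prime p → (n e : ℕ) → 2 ≤ n → 1 ≤ e →
    HasCount n 1 (p ^ e) (n C 2)
proposition3p2 p p-prime n e _ e≥1 = subst (HasCount n 1 (p ^ e)) (sym (nC2≡triangle n))
  ( diagonalSubringAt p-prime e≥1 n
  , diagonalSubringAt-injective p-prime e≥1 n
  , diagonalSubringAt-surjective p-prime e≥1 n )
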